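{- For every integer $n\ge 9$, $\mathrm{wdim}_4(K_n\times K_n)\le 2n+1+\lfloor n/4\rfloor$.
   Context: $K_n\times K_n$ is the direct product of two complete graphs: vertex set $[n]\times[n]$ with $[n]=\{1,\dots,n\}$, where $(i,j)$ and $(i',j')$ are adjacent iff $i\ne i'$ and $j\ne j'$. With $d$ the shortest-path distance, for $S\subseteq V$ and vertices $x,y,z$: $\Delta_z(x,y)=|d(x,z)-d(y,z)|$ and $\Delta_S(x,y)=\sum_{z\in S}\Delta_z(x,y)$. A set $S$ of vertices is a weak $k$-resolving set if $\Delta_S(x,y)\ge k$ for all distinct vertices $x,y$. The weak $k$-metric dimension $\mathrm{wdim}_k(G)$ is the minimum cardinality of a weak $k$-resolving set of $G$. -}

module Defs where

open import Data.Nat using (ℕ; zero; suc; _+_; _*_; _≤_; ∣_-_∣)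
open import Data.Fin using (Fin)
open import Data.Fin.Properties using (_≟_)
open import Data.Bool using (Bool; true; false; _∧_; _∨_; not; if_then_else_)
open import Data.Product using (Σ; _×_; _,_)
open import Data.List using (List; []; _∷_; map; concatMap)
open import Data.Bool.ListAction using (any)
open import Data.Nat.ListAction using (sum)
open import Data.List.Relation.Unary.Unique.Propositional using (Unique)
open import Relation.Nullary.Decidable using (⌊_⌋)
open import Relation.Binary.PropositionalEquality using (_≢_)
import Data.List as L

Vertex : ℕ → Set
Vertex n = Fin n × Fin n

allFinL : (n : ℕ) → List (Fin n)
allFinL n = L.allFin n

vertices : (n : ℕ) → List (Vertex n)
vertices n = concatMap (λ i → map (λ j → (i , j)) (allFinL n)) (allFinL n)

_==_ : ∀ {n} → Vertex n → Vertex n → Bool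
(i , j) == (i' , j') = ⌊ i ≟ i' ⌋ ∧ ⌊ j ≟ j' ⌋

adj : ∀ {n} → Vertex n → Vertex n → Bool
adj (i , j) (i' , j') = not ⌊ i ≟ i' ⌋ ∧ not ⌊ j ≟ j' ⌋

reachWithin : ∀ {n} → ℕ → Vertex n → Vertex n → Bool
reachWithin zero x y = x == y
reachWithin {n} (suc k) x y =
  (x == y) ∨ any (λ z → adj x z ∧ reachWithin k z y) (vertices n)

search : ∀ {n} → ℕ → ℕ → Vertex n → Vertex n → ℕ
search k zero x y = k
search k (suc fuel) x y =
  if reachWithin k x y then k else search (suc k) fuel x y

-- shortest-path distance d(x,y); any walk can be shortened to a path
-- with fewer than n*n edges, so searching k ∈ {0,…,n*n} suffices
-- (K_n × K_n is connected for n ≥ 3, so the default is never used there).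
dist : ∀ {n} → Vertex n → Vertex n → ℕ
dist {n} x y = search 0 (suc (n * n)) x y

Δ : ∀ {n} → Vertex n → Vertex n → Vertex n → ℕ
Δ z x y = ∣ dist x z - dist y z ∣

ΔS : ∀ {n} → List (Vertex n) → Vertex n → Vertex n → ℕ
ΔS S x y = sum (map (λ z → Δ z x y) S)

IsWeakResolving : ∀ {n} → ℕ → List (Vertex n) → Set
IsWeakResolving {n} k S =
  Unique S × (∀ (x y : Vertex n) → x ≢ y → k ≤ ΔS S x y)

-- wdim_k(K_n × K_n) ≤ m  :⟺  some weak k-resolving set has cardinality ≤ m
-- (wdim_k is the minimum such cardinality)
WdimLe : ℕ → ℕ → ℕ → Set
WdimLe n k m = Σ (List (Vertex n)) λ S → IsWeakResolving k S × L.length S ≤ m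

module Submission where

-- A symmetric 0/1 matrix G on [n] × [n] (a graph on [n], loops allowed) gives the vertex set
-- S = {(k , l) : G k l}, whose size is the volume (sum of degrees) of G.  For n ≥ 3 any two
-- vertices of K_n × K_n have a common neighbour, so all distances are 0, 1 or 2, and for
-- x = (i , j), y = (i' , j') the value Δ_z(x , y) is at least the number of the lines row i, row i',
-- column j, column j' through z, unless z is one of the corners x, y, (i , j'), (i' , j).  Summing over S,
-- Δ_S(x , y) ≥ deg i + deg i' + deg j + deg j' − (corner weight), so minimum degree 2 gives
-- Δ_S ≥ 4 unless (i , j'), (i' , j) and x or y all lie in S, a case excluded by a finite check.
--
-- G is taken block diagonal: writing n = 4K + s with 4 ≤ s ≤ 7, K copies of a graph on 4 vertices
-- of volume 9 and one graph on s vertices of volume at most 2s + 2, for a total of at most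
-- 2n + K + 2 = 2n + 1 + ⌊n/4⌋.  The blocks are checked by evaluation and the properties pass to
-- block sums, so the bound holds for every n ≥ 4.

open import Defs
open import Data.Nat using (ℕ; zero; suc; _+_; _*_; _∸_; _≤_; _<_; _/_; _≡ᵇ_; _<ᵇ_; _≤?_; z≤n; s≤s; z<s; s<s; ∣_-_∣)
import Data.Nat as ℕ
open import Data.Nat.Properties
  using (+-assoc; +-identityʳ; *-zeroʳ; *-distribˡ-+; +-mono-≤; +-monoʳ-≤; *-monoʳ-≤; +-cancelʳ-≤;
         ≤-refl; ≤-trans; ≤-reflexive; n≤1+n; m≤m+n; m+n∸m≡n; ∸-monoˡ-<; ∸-cancelʳ-≡;
         <-≤-connex; ≮⇒≥; ≤⇒≯; <ᵇ⇒<; <⇒<ᵇ; allUpTo?; module ≤-Reasoning)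
open import Data.Nat.DivMod using (m/n≡1+[m∸n]/n)
open import Data.Nat.Tactic.RingSolver using (solve-∀)
open import Data.Bool using (Bool; true; false; _∧_; _∨_; not; T; if_then_else_)
open import Data.Bool.Properties using (∨-comm; T-≡; T-∧; T-∨; ¬-not)
open import Function.Bundles using (Equivalence; _⇔_; mk⇔)
open import Data.Product using (_×_; _,_; proj₁; proj₂; ∃)
open import Data.Sum using (inj₁; inj₂)
open import Data.Fin using (Fin; zero; suc; toℕ)
open import Data.Fin.Properties using (_≟_; toℕ<n; toℕ-injective; suc-injective)
open import Data.List using (List; []; _∷_; _++_; map; concat; concatMap; filter; cartesianProduct; allFin; length; tabulate)
open import Data.List.Membership.Propositional using (_∈_; lose)
open import Data.List.Membership.Propositional.Properties using (∈-cartesianProduct⁺; ∈-allFin)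
open import Data.List.Relation.Unary.Any using (satisfied)
open import Data.List.Relation.Unary.Any.Properties using (any⁺; any⁻)
open import Data.List.Relation.Unary.Unique.Propositional using (Unique)
open import Data.List.Relation.Unary.Unique.Propositional.Properties using (filter⁺; cartesianProduct⁺; allFin⁺)
open import Data.Bool.ListAction using (any)
open import Data.Nat.ListAction using (sum)
open import Data.Nat.ListAction.Properties using (sum-++)
open import Data.List.Properties using (map-cong; map-∘; map-++; map-tabulate)
open import Data.Unit using (tt)
open import Data.Empty using (⊥-elim)
open import Function using (_∘_; id)
open import Relation.Nullary using (¬_; Dec; yes; no; contradiction)
open import Relation.Nullary.Decidable using (⌊_⌋; True; toWitness; ¬?; _→-dec_; T?)
open import Relation.Binary.PropositionalEquality using (_≡_; _≢_; refl; sym; trans; cong; cong₂; subst; module ≡-Reasoning)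

Σ< : ℕ → (ℕ → ℕ) → ℕ
Σ< zero    h = 0
Σ< (suc n) h = h 0 + Σ< n (h ∘ suc)

Σ<-cong : ∀ n {f g : ℕ → ℕ} → (∀ {a} → a < n → f a ≡ g a) → Σ< n f ≡ Σ< n g
Σ<-cong zero    f≡g = refl
Σ<-cong (suc n) f≡g = cong₂ _+_ (f≡g z<s) (Σ<-cong n (f≡g ∘ s<s))

Σ<-zero : ∀ n {f : ℕ → ℕ} → (∀ {a} → a < n → f a ≡ 0) → Σ< n f ≡ 0
Σ<-zero zero    f≡0 = refl
Σ<-zero (suc n) f≡0 rewrite f≡0 z<s = Σ<-zero n (f≡0 ∘ s<s)

Σ<-+ : ∀ m k (h : ℕ → ℕ) → Σ< (m + k) h ≡ Σ< m h + Σ< k (λ c → h (m + c))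
Σ<-+ zero    k h = refl
Σ<-+ (suc m) k h = trans (cong (h 0 +_) (Σ<-+ m k (h ∘ suc))) (sym (+-assoc (h 0) _ _))

module _ {A : Set} where

  sum-map-+ : ∀ (f g : A → ℕ) xs → sum (map (λ z → f z + g z) xs) ≡ sum (map f xs) + sum (map g xs)
  sum-map-+ f g []       = refl
  sum-map-+ f g (x ∷ xs) rewrite sum-map-+ f g xs = shuffle (f x) (g x) (sum (map f xs)) (sum (map g xs))
    where
    shuffle : ∀ a b c d → (a + b) + (c + d) ≡ (a + c) + (b + d)
    shuffle = solve-∀

  sum-map-+₄ : ∀ (f₁ f₂ f₃ f₄ : A → ℕ) xs →
    sum (map (λ z → f₁ z + f₂ z + f₃ z + f₄ z) xs) ≡
    sum (map f₁ xs) + sum (map f₂ xs) + sum (map f₃ xs) + sum (map f₄ xs)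
  sum-map-+₄ f₁ f₂ f₃ f₄ xs =
    trans (sum-map-+ _ f₄ xs) (cong (_+ _) (trans (sum-map-+ _ f₃ xs) (cong (_+ _) (sum-map-+ f₁ f₂ xs))))

  sum-map-* : ∀ c (f : A → ℕ) xs → sum (map (λ z → c * f z) xs) ≡ c * sum (map f xs)
  sum-map-* c f []       = sym (*-zeroʳ c)
  sum-map-* c f (x ∷ xs) = trans (cong (c * f x +_) (sum-map-* c f xs)) (sym (*-distribˡ-+ c (f x) _))

  sum-map-zero : ∀ {f : A → ℕ} xs → (∀ z → f z ≡ 0) → sum (map f xs) ≡ 0
  sum-map-zero []       f≡0 = refl
  sum-map-zero (x ∷ xs) f≡0 rewrite f≡0 x = sum-map-zero xs f≡0

  sum-map-mono : ∀ {f g : A → ℕ} xs → (∀ z → f z ≤ g z) → sum (map f xs) ≤ sum (map g xs)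
  sum-map-mono []       f≤g = z≤n
  sum-map-mono (x ∷ xs) f≤g = +-mono-≤ (f≤g x) (sum-map-mono xs f≤g)

  sum-map-filter : ∀ (b : A → Bool) (f : A → ℕ) xs →
    sum (map f (filter (T? ∘ b) xs)) ≡ sum (map (λ z → if b z then f z else 0) xs)
  sum-map-filter b f []       = refl
  sum-map-filter b f (x ∷ xs) with b x
  ... | true  = cong (f x +_) (sum-map-filter b f xs)
  ... | false = sum-map-filter b f xs

  sum-map-concat : ∀ {B : Set} (g : B → ℕ) (F : A → List B) xs →
    sum (map g (concat (map F xs))) ≡ sum (map (λ x → sum (map g (F x))) xs)
  sum-map-concat g F []       = refl
  sum-map-concat g F (x ∷ xs) = begin
    sum (map g (F x ++ concat (map F xs)))            ≡⟨ cong sum (map-++ g (F x) _) ⟩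
    sum (map g (F x) ++ map g (concat (map F xs)))    ≡⟨ sum-++ (map g (F x)) _ ⟩
    sum (map g (F x)) + sum (map g (concat (map F xs))) ≡⟨ cong (_ +_) (sum-map-concat g F xs) ⟩
    sum (map g (F x)) + sum (map (λ x → sum (map g (F x))) xs) ∎
    where open ≡-Reasoning

  length≡sum : (xs : List A) → length xs ≡ sum (map (λ _ → 1) xs)
  length≡sum []       = refl
  length≡sum (x ∷ xs) = cong suc (length≡sum xs)

sumFin : ∀ n → (Fin n → ℕ) → ℕ
sumFin n h = sum (map h (allFin n))

sumFin-cong : ∀ n {f g : Fin n → ℕ} → (∀ k → f k ≡ g k) → sumFin n f ≡ sumFin n g
sumFin-cong n f≡g = cong sum (map-cong f≡g (allFin n))

sumFin-toℕ : ∀ n (h : ℕ → ℕ) → sumFin n (h ∘ toℕ) ≡ Σ< n h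
sumFin-toℕ n h = trans (cong sum (map-tabulate {n = n} id (h ∘ toℕ))) (go n h)
  where
  go : ∀ n (h : ℕ → ℕ) → sum (tabulate {n = n} (h ∘ toℕ)) ≡ Σ< n h
  go zero    h = refl
  go (suc n) h = cong (h 0 +_) (go n (h ∘ suc))

sumFin-single : ∀ n (h : Fin n → ℕ) (i : Fin n) → (∀ k → k ≢ i → h k ≡ 0) → sumFin n h ≡ h i
sumFin-single n h i h≡0 = trans (cong sum (map-tabulate {n = n} id h)) (go n h i h≡0)
  where
  zeros : ∀ n (g : Fin n → ℕ) → (∀ k → g k ≡ 0) → sum (tabulate g) ≡ 0
  zeros zero    g g≡0 = refl
  zeros (suc n) g g≡0 rewrite g≡0 zero = zeros n (g ∘ suc) (g≡0 ∘ suc)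
  go : ∀ n (h : Fin n → ℕ) (i : Fin n) → (∀ k → k ≢ i → h k ≡ 0) → sum (tabulate h) ≡ h i
  go (suc n) h zero    h≡0 = trans (cong (h zero +_) (zeros n (h ∘ suc) (λ k → h≡0 (suc k) λ ()))) (+-identityʳ _)
  go (suc n) h (suc i) h≡0 rewrite h≡0 zero (λ ()) =
    go n (h ∘ suc) i (λ k k≢i → h≡0 (suc k) (k≢i ∘ suc-injective))

⌊≟⌋-refl : ∀ {n} (i : Fin n) → ⌊ i ≟ i ⌋ ≡ true
⌊≟⌋-refl i with i ≟ i
... | yes _   = refl
... | no i≢i  = contradiction refl i≢i

⌊≟⌋-≢ : ∀ {n} {i k : Fin n} → i ≢ k → ⌊ i ≟ k ⌋ ≡ false
⌊≟⌋-≢ {i = i} {k} i≢k with i ≟ k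
... | yes i≡k = contradiction i≡k i≢k
... | no _    = refl

sumFin-select : ∀ n (i : Fin n) (h : Fin n → Bool → ℕ) → (∀ k → h k false ≡ 0) →
  sumFin n (λ k → h k ⌊ i ≟ k ⌋) ≡ h i true
sumFin-select n i h h≡0 = trans
  (sumFin-single n _ i (λ k k≢i → trans (cong (h k) (⌊≟⌋-≢ (k≢i ∘ sym))) (h≡0 k)))
  (cong (h i) (⌊≟⌋-refl i))

sum-vertices : ∀ {n} (g : Vertex n → ℕ) → sum (map g (vertices n)) ≡ sumFin n (λ k → sumFin n (λ l → g (k , l)))
sum-vertices {n} g = trans (sum-map-concat g _ (allFin n))
  (sumFin-cong n (λ k → cong sum (sym (map-∘ (allFin n)))))

-- Only the entries on [0, n) matter for a graph on n vertices.
Graph : Set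
Graph = ℕ → ℕ → Bool

[_] : Bool → ℕ
[ b ] = if b then 1 else 0

degree : ℕ → Graph → ℕ → ℕ
degree n G a = Σ< n (λ c → [ G a c ])

volume : ℕ → Graph → ℕ
volume n G = Σ< n (degree n G)

Symmetric : Graph → Set
Symmetric G = ∀ a c → G a c ≡ G c a

MinDegree : ℕ → Graph → ℕ → Set
MinDegree n G d = ∀ {a} → a < n → d ≤ degree n G a

-- The amount by which S-vertices at the corners (a , c), (a' , c'), (a , c'), (a' , c) can make the
-- row and column counts of x = (a , c) and y = (a' , c') exceed Δ_S(x , y).
cornerWeight : Bool → Bool → Bool → Bool → ℕ
cornerWeight p q r s = [ p ] + [ q ] + 2 * [ r ] + 2 * [ s ]

SquareBound : Graph → (ℕ → ℕ) → ℕ → ℕ → ℕ → ℕ → Set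
SquareBound G d a a' c c' =
  T (G a c' ∧ G a' c ∧ (G a c ∨ G a' c')) →
  4 + cornerWeight (G a c) (G a' c') (G a c') (G a' c) ≤ d a + d a' + d c + d c'

Separating : ℕ → Graph → Set
Separating n G = ∀ {a} → a < n → ∀ {a'} → a' < n → ∀ {c} → c < n → ∀ {c'} → c' < n →
  a ≢ a' → c ≢ c' → SquareBound G (degree n G) a a' c c'

[]≤1 : ∀ b → [ b ] ≤ 1
[]≤1 true  = ≤-refl
[]≤1 false = z≤n

cornerWeight≤4 : ∀ p q r s → ¬ T (r ∧ s ∧ (p ∨ q)) → cornerWeight p q r s ≤ 4
cornerWeight≤4 p     q     false s     _ = +-mono-≤ (+-mono-≤ (+-mono-≤ ([]≤1 p) ([]≤1 q)) ≤-refl) (*-monoʳ-≤ 2 ([]≤1 s))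
cornerWeight≤4 p     q     true  false _ = +-mono-≤ (+-mono-≤ (+-mono-≤ ([]≤1 p) ([]≤1 q)) ≤-refl) ≤-refl
cornerWeight≤4 false false true  true  _ = ≤-refl
cornerWeight≤4 true  q     true  true  ¬c = contradiction tt ¬c
cornerWeight≤4 false true  true  true  ¬c = contradiction tt ¬c

4≤-from-corners : ∀ p q r s {D Δₛ} → D ≤ Δₛ + cornerWeight p q r s → 8 ≤ D →
  (T (r ∧ s ∧ (p ∨ q)) → 4 + cornerWeight p q r s ≤ D) → 4 ≤ Δₛ
4≤-from-corners p q r s {D} {Δₛ} D≤ 8≤D square =
  +-cancelʳ-≤ (cornerWeight p q r s) 4 Δₛ (≤-trans 4+w≤D D≤)
  where
  4+w≤D : 4 + cornerWeight p q r s ≤ D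
  4+w≤D with T? (r ∧ s ∧ (p ∨ q))
  ... | yes c  = square c
  ... | no ¬c  = ≤-trans (+-monoʳ-≤ 4 (cornerWeight≤4 p q r s ¬c)) 8≤D

T-injective : ∀ {p q} → T p ⇔ T q → p ≡ q
T-injective {false} {false} _   = refl
T-injective {false} {true}  p⇔q = ⊥-elim (Equivalence.from p⇔q tt)
T-injective {true}  {false} p⇔q = ⊥-elim (Equivalence.to p⇔q tt)
T-injective {true}  {true}  _   = refl

δ : ∀ {n} → Vertex n → Vertex n → ℕ
δ x z = if x == z then 0 else if adj x z then 1 else 2

module _ {n : ℕ} where

  ==-refl : (x : Vertex n) → T (x == x)
  ==-refl (i , j) rewrite ⌊≟⌋-refl i | ⌊≟⌋-refl j = tt

  ==⇒≡ : ∀ {x z : Vertex n} → T (x == z) → x ≡ z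
  ==⇒≡ {i , j} {k , l} eq with i ≟ k | j ≟ l
  ... | yes refl | yes refl = refl

  adj-intro : ∀ {i j k l : Fin n} → i ≢ k → j ≢ l → T (adj (i , j) (k , l))
  adj-intro i≢k j≢l rewrite ⌊≟⌋-≢ i≢k | ⌊≟⌋-≢ j≢l = tt

  vertices≡cartesianProduct : vertices n ≡ cartesianProduct (allFin n) (allFin n)
  vertices≡cartesianProduct = go (allFin n)
    where
    go : ∀ is → concatMap (λ i → map (i ,_) (allFin n)) is ≡ cartesianProduct is (allFin n)
    go []       = refl
    go (i ∷ is) = cong (map (i ,_) (allFin n) ++_) (go is)

  ∈-vertices : (x : Vertex n) → x ∈ vertices n
  ∈-vertices (i , j) = subst ((i , j) ∈_) (sym vertices≡cartesianProduct)
    (∈-cartesianProduct⁺ (∈-allFin i) (∈-allFin j))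

  vertices-unique : Unique (vertices n)
  vertices-unique = subst Unique (sym vertices≡cartesianProduct)
    (cartesianProduct⁺ (allFin⁺ n) (allFin⁺ n))

  any-vertices⁺ : ∀ (g : Vertex n → Bool) x → T (g x) → T (any g (vertices n))
  any-vertices⁺ g x gx = any⁺ g (lose (∈-vertices x) gx)

  any-adj-== : ∀ x z → any (λ w → adj x w ∧ (w == z)) (vertices n) ≡ adj x z
  any-adj-== x z = T-injective (mk⇔ to from)
    where
    to : T (any (λ w → adj x w ∧ (w == z)) (vertices n)) → T (adj x z)
    to hit with satisfied (any⁻ _ (vertices n) hit)
    ... | w , adj∧== with Equivalence.to (T-∧ {adj x w}) adj∧==
    ... | xw , w==z = subst (T ∘ adj x) (==⇒≡ w==z) xw
    from : T (adj x z) → T (any (λ w → adj x w ∧ (w == z)) (vertices n))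
    from xz = any-vertices⁺ _ z (Equivalence.from (T-∧ {adj x z}) (xz , ==-refl z))

fresh : ∀ {m} (i i' : Fin (3 + m)) → ∃ λ k → i ≢ k × i' ≢ k
fresh zero          zero          = suc zero       , (λ ()) , (λ ())
fresh zero          (suc zero)    = suc (suc zero) , (λ ()) , (λ ())
fresh zero          (suc (suc _)) = suc zero       , (λ ()) , (λ ())
fresh (suc zero)    zero          = suc (suc zero) , (λ ()) , (λ ())
fresh (suc zero)    (suc zero)    = zero           , (λ ()) , (λ ())
fresh (suc zero)    (suc (suc _)) = zero           , (λ ()) , (λ ())
fresh (suc (suc _)) zero          = suc zero       , (λ ()) , (λ ())
fresh (suc (suc _)) (suc zero)    = zero           , (λ ()) , (λ ())
fresh (suc (suc _)) (suc (suc _)) = zero           , (λ ()) , (λ ())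

module _ {m : ℕ} where

  commonNeighbour : (x z : Vertex (3 + m)) → ∃ λ w → T (adj x w) × T (adj w z)
  commonNeighbour (i , j) (i' , j') with fresh i i' | fresh j j'
  ... | k , i≢k , i'≢k | l , j≢l , j'≢l =
    (k , l) , adj-intro i≢k j≢l , adj-intro (i'≢k ∘ sym) (j'≢l ∘ sym)

  reachWithin-2 : (x z : Vertex (3 + m)) → T (reachWithin 2 x z)
  reachWithin-2 x z with commonNeighbour x z
  ... | w , xw , wz =
    Equivalence.from (T-∨ {x == z}) (inj₂ (any-vertices⁺ (λ u → adj x u ∧ reachWithin 1 u z) w x→w→z))
    where
    w→z : T (reachWithin 1 w z)
    w→z = Equivalence.from (T-∨ {w == z}) (inj₂ (any-vertices⁺ (λ u → adj w u ∧ (u == z)) z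
            (Equivalence.from (T-∧ {adj w z}) (wz , ==-refl z))))
    x→w→z : T (adj x w ∧ reachWithin 1 w z)
    x→w→z = Equivalence.from (T-∧ {adj x w}) (xw , w→z)

  dist≡δ : (x z : Vertex (3 + m)) → dist x z ≡ δ x z
  dist≡δ x z = begin
    dist x z
      ≡⟨ cutoff (x == z) (reachWithin 1 x z) _ (Equivalence.to T-≡ (reachWithin-2 x z)) ⟩
    (if x == z then 0 else if (x == z) ∨ any (λ w → adj x w ∧ (w == z)) (vertices _) then 1 else 2)
      ≡⟨ cong (λ b → if x == z then 0 else if (x == z) ∨ b then 1 else 2) (any-adj-== x z) ⟩
    (if x == z then 0 else if (x == z) ∨ adj x z then 1 else 2)
      ≡⟨ absorb (x == z) (adj x z) ⟩
    δ x z ∎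
    where
    open ≡-Reasoning
    -- dist is a search returning the first radius reached, and radius 2 is always reached.
    cutoff : ∀ b₀ b₁ {b₂} t → b₂ ≡ true →
      (if b₀ then 0 else if b₁ then 1 else if b₂ then 2 else t) ≡ (if b₀ then 0 else if b₁ then 1 else 2)
    cutoff b₀ b₁ t refl = refl
    absorb : ∀ p q → (if p then 0 else if p ∨ q then 1 else 2) ≡ (if p then 0 else if q then 1 else 2)
    absorb true  q = refl
    absorb false q = refl

edgeAt : ∀ {n} → Graph → Vertex n → Bool
edgeAt G (k , l) = G (toℕ k) (toℕ l)

edgeSet : ∀ n → Graph → List (Vertex n)
edgeSet n G = filter (T? ∘ edgeAt G) (vertices n)

inRow inColumn : ∀ {n} → Fin n → Vertex n → ℕ
inRow    i z = [ ⌊ i ≟ proj₁ z ⌋ ]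
inColumn j z = [ ⌊ j ≟ proj₂ z ⌋ ]

module _ {n : ℕ} (G : Graph) where

  private
    S = edgeSet n G

    masked-0 : ∀ b {v} → v ≡ 0 → (if b then v else 0) ≡ 0
    masked-0 true  v≡0 = v≡0
    masked-0 false _   = refl

    sumFin-masked-0 : ∀ (b : Fin n → Bool) → sumFin n (λ l → if b l then 0 else 0) ≡ 0
    sumFin-masked-0 b = sum-map-zero (allFin n) (λ l → masked-0 (b l) refl)

  sum-edgeSet : ∀ (f : Vertex n → ℕ) →
    sum (map f S) ≡ sumFin n (λ k → sumFin n (λ l → if edgeAt G (k , l) then f (k , l) else 0))
  sum-edgeSet f =
    trans (sum-map-filter (edgeAt G) f (vertices n)) (sum-vertices (λ z → if edgeAt G z then f z else 0))

  length-edgeSet : length S ≡ volume n G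
  length-edgeSet = begin
    length S                                                ≡⟨ length≡sum S ⟩
    sum (map (λ _ → 1) S)                                   ≡⟨ sum-edgeSet _ ⟩
    sumFin n (λ k → sumFin n (λ l → [ edgeAt G (k , l) ])) ≡⟨ sumFin-cong n (λ k → sumFin-toℕ n _) ⟩
    sumFin n (λ k → degree n G (toℕ k))                    ≡⟨ sumFin-toℕ n _ ⟩
    volume n G                                              ∎
    where open ≡-Reasoning

  sum-inRow : ∀ i → sum (map (inRow i) S) ≡ degree n G (toℕ i)
  sum-inRow i = begin
    sum (map (inRow i) S)
      ≡⟨ sum-edgeSet _ ⟩
    sumFin n (λ k → sumFin n (λ l → if edgeAt G (k , l) then [ ⌊ i ≟ k ⌋ ] else 0))
      ≡⟨ sumFin-select n i (λ k e → sumFin n (λ l → if edgeAt G (k , l) then [ e ] else 0))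
                          (λ k → sumFin-masked-0 _) ⟩
    sumFin n (λ l → [ edgeAt G (i , l) ])
      ≡⟨ sumFin-toℕ n _ ⟩
    degree n G (toℕ i) ∎
    where open ≡-Reasoning

  sum-inColumn : Symmetric G → ∀ j → sum (map (inColumn j) S) ≡ degree n G (toℕ j)
  sum-inColumn symG j = begin
    sum (map (inColumn j) S)
      ≡⟨ sum-edgeSet _ ⟩
    sumFin n (λ k → sumFin n (λ l → if edgeAt G (k , l) then [ ⌊ j ≟ l ⌋ ] else 0))
      ≡⟨ sumFin-cong n (λ k → sumFin-select n j (λ l e → if edgeAt G (k , l) then [ e ] else 0)
                                                 (λ l → masked-0 _ refl)) ⟩
    sumFin n (λ k → [ edgeAt G (k , j) ])
      ≡⟨ sumFin-toℕ n _ ⟩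
    Σ< n (λ a → [ G a (toℕ j) ])
      ≡⟨ Σ<-cong n (λ {a} _ → cong [_] (symG a (toℕ j))) ⟩
    degree n G (toℕ j) ∎
    where open ≡-Reasoning

  sum-== : ∀ x → sum (map (λ z → [ x == z ]) S) ≡ [ edgeAt G x ]
  sum-== (i , j) = begin
    sum (map (λ z → [ (i , j) == z ]) S)
      ≡⟨ sum-edgeSet _ ⟩
    sumFin n (λ k → sumFin n (λ l → if edgeAt G (k , l) then [ ⌊ i ≟ k ⌋ ∧ ⌊ j ≟ l ⌋ ] else 0))
      ≡⟨ sumFin-select n i (λ k e → sumFin n (λ l → if edgeAt G (k , l) then [ e ∧ ⌊ j ≟ l ⌋ ] else 0))
                          (λ k → sumFin-masked-0 _) ⟩
    sumFin n (λ l → if edgeAt G (i , l) then [ ⌊ j ≟ l ⌋ ] else 0)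
      ≡⟨ sumFin-select n j (λ l e → if edgeAt G (i , l) then [ e ] else 0) (λ l → masked-0 _ refl) ⟩
    [ edgeAt G (i , j) ] ∎
    where open ≡-Reasoning

  sum-cornerWeight : ∀ x₁ x₂ x₃ x₄ →
    sum (map (λ z → cornerWeight (x₁ == z) (x₂ == z) (x₃ == z) (x₄ == z)) S) ≡
    cornerWeight (edgeAt G x₁) (edgeAt G x₂) (edgeAt G x₃) (edgeAt G x₄)
  sum-cornerWeight x₁ x₂ x₃ x₄ = trans
    (sum-map-+₄ (λ z → [ x₁ == z ]) (λ z → [ x₂ == z ]) (λ z → 2 * [ x₃ == z ]) (λ z → 2 * [ x₄ == z ]) S)
    (cong₂ _+_ (cong₂ _+_ (cong₂ _+_ (sum-== x₁) (sum-== x₂)) (twice x₃)) (twice x₄))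
    where
    twice : ∀ x → sum (map (λ z → 2 * [ x == z ]) S) ≡ 2 * [ edgeAt G x ]
    twice x = trans (sum-map-* 2 (λ z → [ x == z ]) S) (cong (2 *_) (sum-== x))

module _ {n : ℕ} where

  pointwise-sameRow : ∀ i {j j'} (z : Vertex n) → j ≢ j' →
    inColumn j z + inColumn j' z ≤ ∣ δ (i , j) z - δ (i , j') z ∣
  pointwise-sameRow i {j} {j'} (k , l) j≢j' with i ≟ k | j ≟ l | j' ≟ l
  ... | _     | yes refl | yes refl = contradiction refl j≢j'
  ... | yes _ | yes _    | no _     = s≤s z≤n
  ... | yes _ | no _     | yes _    = s≤s z≤n
  ... | yes _ | no _     | no _     = z≤n
  ... | no _  | yes _    | no _     = s≤s z≤n
  ... | no _  | no _     | yes _    = s≤s z≤n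
  ... | no _  | no _     | no _     = z≤n

  pointwise-sameColumn : ∀ {i i'} j (z : Vertex n) → i ≢ i' →
    inRow i z + inRow i' z ≤ ∣ δ (i , j) z - δ (i' , j) z ∣
  pointwise-sameColumn {i} {i'} j (k , l) i≢i' with i ≟ k | i' ≟ k | j ≟ l
  ... | yes refl | yes refl | _     = contradiction refl i≢i'
  ... | yes _    | no _     | yes _ = s≤s z≤n
  ... | yes _    | no _     | no _  = s≤s z≤n
  ... | no _     | yes _    | yes _ = s≤s z≤n
  ... | no _     | yes _    | no _  = s≤s z≤n
  ... | no _     | no _     | _     = z≤n

  pointwise-cross : ∀ {i i' j j'} (z : Vertex n) → i ≢ i' → j ≢ j' →
    inRow i z + inRow i' z + inColumn j z + inColumn j' z ≤
    ∣ δ (i , j) z - δ (i' , j') z ∣ + cornerWeight ((i , j) == z) ((i' , j') == z) ((i , j') == z) ((i' , j) == z)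
  pointwise-cross {i} {i'} {j} {j'} (k , l) i≢i' j≢j' with i ≟ k | i' ≟ k | j ≟ l | j' ≟ l
  ... | yes refl | yes refl | _        | _        = contradiction refl i≢i'
  ... | _        | _        | yes refl | yes refl = contradiction refl j≢j'
  ... | yes _    | no _     | yes _    | no _     = s≤s (s≤s z≤n)
  ... | yes _    | no _     | no _     | yes _    = s≤s (s≤s z≤n)
  ... | yes _    | no _     | no _     | no _     = s≤s z≤n
  ... | no _     | yes _    | yes _    | no _     = s≤s (s≤s z≤n)
  ... | no _     | yes _    | no _     | yes _    = s≤s (s≤s z≤n)
  ... | no _     | yes _    | no _     | no _     = s≤s z≤n
  ... | no _     | no _     | yes _    | no _     = s≤s z≤n
  ... | no _     | no _     | no _     | yes _    = s≤s z≤n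
  ... | no _     | no _     | no _     | no _     = z≤n

module _ {m : ℕ} (G : Graph) (symG : Symmetric G) where

  private
    S = edgeSet (3 + m) G

    deg : Fin (3 + m) → ℕ
    deg = degree (3 + m) G ∘ toℕ

    Δ≡ : ∀ (z x y : Vertex (3 + m)) → Δ z x y ≡ ∣ δ x z - δ y z ∣
    Δ≡ z x y = cong₂ ∣_-_∣ (dist≡δ x z) (dist≡δ y z)

  ΔS-sameRow : ∀ i {j j'} → j ≢ j' → deg j + deg j' ≤ ΔS S (i , j) (i , j')
  ΔS-sameRow i {j} {j'} j≢j' = begin
    deg j + deg j'                                         ≡⟨ sym (cong₂ _+_ (sum-inColumn G symG j) (sum-inColumn G symG j')) ⟩
    sum (map (inColumn j) S) + sum (map (inColumn j') S)   ≡⟨ sym (sum-map-+ (inColumn j) (inColumn j') S) ⟩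
    sum (map (λ z → inColumn j z + inColumn j' z) S)       ≤⟨ sum-map-mono S pointwise ⟩
    ΔS S (i , j) (i , j')                                  ∎
    where
    open ≤-Reasoning
    pointwise : ∀ z → inColumn j z + inColumn j' z ≤ Δ z (i , j) (i , j')
    pointwise z = subst (_ ≤_) (sym (Δ≡ z (i , j) (i , j'))) (pointwise-sameRow i z j≢j')

  ΔS-sameColumn : ∀ {i i'} j → i ≢ i' → deg i + deg i' ≤ ΔS S (i , j) (i' , j)
  ΔS-sameColumn {i} {i'} j i≢i' = begin
    deg i + deg i'                                   ≡⟨ sym (cong₂ _+_ (sum-inRow G i) (sum-inRow G i')) ⟩
    sum (map (inRow i) S) + sum (map (inRow i') S)   ≡⟨ sym (sum-map-+ (inRow i) (inRow i') S) ⟩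
    sum (map (λ z → inRow i z + inRow i' z) S)       ≤⟨ sum-map-mono S pointwise ⟩
    ΔS S (i , j) (i' , j)                            ∎
    where
    open ≤-Reasoning
    pointwise : ∀ z → inRow i z + inRow i' z ≤ Δ z (i , j) (i' , j)
    pointwise z = subst (_ ≤_) (sym (Δ≡ z (i , j) (i' , j))) (pointwise-sameColumn j z i≢i')

  ΔS-cross : ∀ {i i' j j'} → i ≢ i' → j ≢ j' →
    deg i + deg i' + deg j + deg j' ≤
    ΔS S (i , j) (i' , j') +
    cornerWeight (edgeAt G (i , j)) (edgeAt G (i' , j')) (edgeAt G (i , j')) (edgeAt G (i' , j))
  ΔS-cross {i} {i'} {j} {j'} i≢i' j≢j' = begin
    deg i + deg i' + deg j + deg j'
      ≡⟨ sym (trans (sum-map-+₄ (inRow i) (inRow i') (inColumn j) (inColumn j') S) lines) ⟩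
    sum (map (λ z → inRow i z + inRow i' z + inColumn j z + inColumn j' z) S)
      ≤⟨ sum-map-mono S pointwise ⟩
    sum (map (λ z → Δ z x y + corner z) S)
      ≡⟨ trans (sum-map-+ (λ z → Δ z x y) corner S) (cong (ΔS S x y +_) (sum-cornerWeight G x y (i , j') (i' , j))) ⟩
    ΔS S x y + cornerWeight (edgeAt G x) (edgeAt G y) (edgeAt G (i , j')) (edgeAt G (i' , j)) ∎
    where
    open ≤-Reasoning
    x = (i , j)
    y = (i' , j')
    corner : Vertex (3 + m) → ℕ
    corner z = cornerWeight (x == z) (y == z) ((i , j') == z) ((i' , j) == z)
    pointwise : ∀ z → inRow i z + inRow i' z + inColumn j z + inColumn j' z ≤ Δ z x y + corner z
    pointwise z = subst (λ t → inRow i z + inRow i' z + inColumn j z + inColumn j' z ≤ t + corner z)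
                        (sym (Δ≡ z x y)) (pointwise-cross z i≢i' j≢j')
    lines : sum (map (inRow i) S) + sum (map (inRow i') S) + sum (map (inColumn j) S) + sum (map (inColumn j') S) ≡
            deg i + deg i' + deg j + deg j'
    lines = cong₂ _+_ (cong₂ _+_ (cong₂ _+_ (sum-inRow G i) (sum-inRow G i')) (sum-inColumn G symG j))
                      (sum-inColumn G symG j')

edgeSet-isWeakResolving : ∀ {n G} → 3 ≤ n → Symmetric G → MinDegree n G 2 → Separating n G →
  IsWeakResolving 4 (edgeSet n G)
edgeSet-isWeakResolving {G = G} (s≤s (s≤s (s≤s _))) symG degG sepG =
  filter⁺ (T? ∘ edgeAt G) vertices-unique , resolves
  where
  resolves : ∀ x y → x ≢ y → 4 ≤ ΔS (edgeSet _ G) x y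
  resolves (i , j) (i' , j') x≢y with i ≟ i' | j ≟ j'
  ... | yes refl | yes refl = contradiction refl x≢y
  ... | yes refl | no j≢j'  = ≤-trans (+-mono-≤ (degG (toℕ<n j)) (degG (toℕ<n j'))) (ΔS-sameRow G symG i j≢j')
  ... | no i≢i'  | yes refl = ≤-trans (+-mono-≤ (degG (toℕ<n i)) (degG (toℕ<n i'))) (ΔS-sameColumn G symG j i≢i')
  ... | no i≢i'  | no j≢j'  =
    4≤-from-corners (G a c) (G a' c') (G a c') (G a' c) (ΔS-cross G symG i≢i' j≢j')
      (+-mono-≤ (+-mono-≤ (+-mono-≤ (degG (toℕ<n i)) (degG (toℕ<n i'))) (degG (toℕ<n j))) (degG (toℕ<n j')))
      (sepG (toℕ<n i) (toℕ<n i') (toℕ<n j) (toℕ<n j') (i≢i' ∘ toℕ-injective) (j≢j' ∘ toℕ-injective))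
    where
    a  = toℕ i
    a' = toℕ i'
    c  = toℕ j
    c' = toℕ j'

squareBound-transport : ∀ {E F : Graph} {d e : ℕ → ℕ} (P : ℕ → Set) (f : ℕ → ℕ) →
  (∀ {x y} → P x → P y → E x y ≡ F (f x) (f y)) → (∀ {x} → P x → d x ≡ e (f x)) →
  ∀ {a a' c c'} → P a → P a' → P c → P c' →
  SquareBound F e (f a) (f a') (f c) (f c') → SquareBound E d a a' c c'
squareBound-transport P f E≡F d≡e pa pa' pc pc' bound
  rewrite E≡F pa pc' | E≡F pa' pc | E≡F pa pc | E≡F pa' pc'
        | d≡e pa | d≡e pa' | d≡e pc | d≡e pc' = bound

_⊕⟨_⟩_ : Graph → ℕ → Graph → Graph
(G ⊕⟨ m ⟩ H) a c = if a <ᵇ m then (c <ᵇ m) ∧ G a c else not (c <ᵇ m) ∧ H (a ∸ m) (c ∸ m)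

<ᵇ-true : ∀ {a m} → a < m → (a <ᵇ m) ≡ true
<ᵇ-true = Equivalence.to T-≡ ∘ <⇒<ᵇ

<ᵇ-false : ∀ {a m} → m ≤ a → (a <ᵇ m) ≡ false
<ᵇ-false {a} {m} m≤a = ¬-not (≤⇒≯ m≤a ∘ <ᵇ⇒< a m ∘ Equivalence.from T-≡)

module _ {G H : Graph} {m : ℕ} where

  private
    E = G ⊕⟨ m ⟩ H

  ⊕-inside : ∀ {a c} → a < m → c < m → E a c ≡ G a c
  ⊕-inside {a} {c} a<m c<m rewrite <ᵇ-true a<m | <ᵇ-true c<m = refl

  ⊕-outside : ∀ {a c} → m ≤ a → m ≤ c → E a c ≡ H (a ∸ m) (c ∸ m)
  ⊕-outside {a} {c} m≤a m≤c rewrite <ᵇ-false m≤a | <ᵇ-false m≤c = refl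

  ⊕-inside-outside : ∀ {a c} → a < m → m ≤ c → E a c ≡ false
  ⊕-inside-outside {a} {c} a<m m≤c rewrite <ᵇ-true a<m | <ᵇ-false m≤c = refl

  ⊕-outside-inside : ∀ {a c} → m ≤ a → c < m → E a c ≡ false
  ⊕-outside-inside {a} {c} m≤a c<m rewrite <ᵇ-false m≤a | <ᵇ-true c<m = refl

  ⊕-edge-side : ∀ {a c} → T (E a c) → (a <ᵇ m) ≡ (c <ᵇ m)
  ⊕-edge-side {a} {c} e with a <ᵇ m | c <ᵇ m
  ... | true  | true  = refl
  ... | false | false = refl

  ⊕-square-sides : ∀ {a a' c c'} → T (E a c' ∧ E a' c ∧ (E a c ∨ E a' c')) →
    (a' <ᵇ m) ≡ (a <ᵇ m) × (c <ᵇ m) ≡ (a <ᵇ m) × (c' <ᵇ m) ≡ (a <ᵇ m)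
  ⊕-square-sides {a} {a'} {c} {c'} square
    with Equivalence.to (T-∧ {E a c'}) square
  ... | ac' , rest with Equivalence.to (T-∧ {E a' c}) rest
  ... | a'c , either with Equivalence.to (T-∨ {E a c}) either
  ... | inj₁ ac   = trans (⊕-edge-side a'c) c~a , c~a , c'~a
    where c~a  = sym (⊕-edge-side ac)
          c'~a = sym (⊕-edge-side ac')
  ... | inj₂ a'c' = a'~a , trans (sym (⊕-edge-side a'c)) a'~a , sym (⊕-edge-side ac')
    where a'~a = trans (⊕-edge-side a'c') (sym (⊕-edge-side ac'))

  ⊕-symmetric : Symmetric G → Symmetric H → Symmetric E
  ⊕-symmetric symG symH a c with a <ᵇ m | c <ᵇ m
  ... | true  | true  = symG a c
  ... | true  | false = refl
  ... | false | true  = refl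
  ... | false | false = symH (a ∸ m) (c ∸ m)

  module _ {k : ℕ} where

    degree-⊕-inside : ∀ {a} → a < m → degree (m + k) E a ≡ degree m G a
    degree-⊕-inside {a} a<m = begin
      degree (m + k) E a                                   ≡⟨ Σ<-+ m k _ ⟩
      Σ< m (λ c → [ E a c ]) + Σ< k (λ c → [ E a (m + c) ]) ≡⟨ cong₂ _+_ (Σ<-cong m inside) (Σ<-zero k outside) ⟩
      degree m G a + 0                                      ≡⟨ +-identityʳ _ ⟩
      degree m G a                                          ∎
      where
      open ≡-Reasoning
      inside : ∀ {c} → c < m → [ E a c ] ≡ [ G a c ]
      inside c<m = cong [_] (⊕-inside a<m c<m)
      outside : ∀ {c} → c < k → [ E a (m + c) ] ≡ 0
      outside {c} _ = cong [_] (⊕-inside-outside a<m (m≤m+n m c))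

    degree-⊕-outside : ∀ {a} → m ≤ a → degree (m + k) E a ≡ degree k H (a ∸ m)
    degree-⊕-outside {a} m≤a = begin
      degree (m + k) E a                                    ≡⟨ Σ<-+ m k _ ⟩
      Σ< m (λ c → [ E a c ]) + Σ< k (λ c → [ E a (m + c) ]) ≡⟨ cong₂ _+_ (Σ<-zero m inside) (Σ<-cong k outside) ⟩
      degree k H (a ∸ m)                                    ∎
      where
      open ≡-Reasoning
      inside : ∀ {c} → c < m → [ E a c ] ≡ 0
      inside c<m = cong [_] (⊕-outside-inside m≤a c<m)
      outside : ∀ {c} → c < k → [ E a (m + c) ] ≡ [ H (a ∸ m) c ]
      outside {c} _ = cong [_] (trans (⊕-outside m≤a (m≤m+n m c)) (cong (H (a ∸ m)) (m+n∸m≡n m c)))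

    volume-⊕ : volume (m + k) E ≡ volume m G + volume k H
    volume-⊕ = trans (Σ<-+ m k _) (cong₂ _+_ (Σ<-cong m degree-⊕-inside) (Σ<-cong k outside))
      where
      outside : ∀ {c} → c < k → degree (m + k) E (m + c) ≡ degree k H c
      outside {c} _ = trans (degree-⊕-outside (m≤m+n m c)) (cong (degree k H) (m+n∸m≡n m c))

    ∸-<-+ : ∀ {a} → m ≤ a → a < m + k → a ∸ m < k
    ∸-<-+ {a} m≤a a<m+k = subst (a ∸ m <_) (m+n∸m≡n m k) (∸-monoˡ-< a<m+k m≤a)

    minDegree-⊕ : ∀ {d} → MinDegree m G d → MinDegree k H d → MinDegree (m + k) E d
    minDegree-⊕ {d} degG degH {a} a<m+k with <-≤-connex a m
    ... | inj₁ a<m = subst (d ≤_) (sym (degree-⊕-inside a<m)) (degG a<m)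
    ... | inj₂ m≤a = subst (d ≤_) (sym (degree-⊕-outside m≤a)) (degH (∸-<-+ m≤a a<m+k))

    separating-⊕ : Separating m G → Separating k H → Separating (m + k) E
    separating-⊕ sepG sepH {a} a< {a'} a'< {c} c< {c'} c'< a≢a' c≢c' square
      with ⊕-square-sides square | <-≤-connex a m
    -- The hypothesis of the square bound joins a to c', a' to c and a or a' to c or c', so all four
    -- indices lie in the same block.
    ... | sides | inj₁ a<m =
          squareBound-transport (_< m) id ⊕-inside degree-⊕-inside a<m a'<m c<m c'<m
            (sepG a<m a'<m c<m c'<m a≢a' c≢c') square
      where
      inside : ∀ {x} → (x <ᵇ m) ≡ (a <ᵇ m) → x < m
      inside {x} eq = <ᵇ⇒< x m (Equivalence.from T-≡ (trans eq (<ᵇ-true a<m)))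
      a'<m = inside (proj₁ sides)
      c<m  = inside (proj₁ (proj₂ sides))
      c'<m = inside (proj₂ (proj₂ sides))
    ... | sides | inj₂ m≤a =
          squareBound-transport {F = H} {e = degree k H} (m ≤_) (_∸ m) ⊕-outside degree-⊕-outside
            m≤a m≤a' m≤c m≤c'
            (sepH (∸-<-+ m≤a a<) (∸-<-+ m≤a' a'<) (∸-<-+ m≤c c<) (∸-<-+ m≤c' c'<)
                  (a≢a' ∘ ∸-cancelʳ-≡ m≤a m≤a') (c≢c' ∘ ∸-cancelʳ-≡ m≤c m≤c')) square
      where
      outside : ∀ {x} → (x <ᵇ m) ≡ (a <ᵇ m) → m ≤ x
      outside {x} eq = ≮⇒≥ λ x<m → contradiction (trans (sym (<ᵇ-true x<m)) (trans eq (<ᵇ-false m≤a))) λ ()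
      m≤a' = outside (proj₁ sides)
      m≤c  = outside (proj₁ (proj₂ sides))
      m≤c' = outside (proj₂ (proj₂ sides))

minDegree? : ∀ n G d → Dec (MinDegree n G d)
minDegree? n G d = allUpTo? (λ a → d ≤? degree n G a) n

separating? : ∀ n G → Dec (Separating n G)
separating? n G =
  allUpTo? (λ a → allUpTo? (λ a' → allUpTo? (λ c → allUpTo? (λ c' →
    ¬? (a ℕ.≟ a') →-dec ¬? (c ℕ.≟ c') →-dec T? _ →-dec _ ≤? _) n) n) n) n

fromEdges : List (ℕ × ℕ) → Graph
fromEdges []             a c = false
fromEdges ((x , y) ∷ es) a c =
  (((x ≡ᵇ a) ∧ (y ≡ᵇ c)) ∨ ((x ≡ᵇ c) ∧ (y ≡ᵇ a))) ∨ fromEdges es a c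

fromEdges-symmetric : ∀ es → Symmetric (fromEdges es)
fromEdges-symmetric []             a c = refl
fromEdges-symmetric ((x , y) ∷ es) a c =
  cong₂ _∨_ (∨-comm ((x ≡ᵇ a) ∧ (y ≡ᵇ c)) _) (fromEdges-symmetric es a c)

block₄-edges block₅-edges block₆-edges block₇-edges : List (ℕ × ℕ)
block₄-edges = (0 , 0) ∷ (0 , 1) ∷ (1 , 2) ∷ (1 , 3) ∷ (2 , 3) ∷ []
block₅-edges = (0 , 1) ∷ (0 , 2) ∷ (0 , 3) ∷ (0 , 4) ∷ (1 , 2) ∷ (3 , 4) ∷ []
block₆-edges = (0 , 0) ∷ (0 , 1) ∷ (0 , 2) ∷ (1 , 2) ∷ (3 , 3) ∷ (3 , 4) ∷ (3 , 5) ∷ (4 , 5) ∷ []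
block₇-edges = block₄-edges ++ (4 , 4) ∷ (4 , 5) ∷ (4 , 6) ∷ (5 , 6) ∷ []

block₄ block₅ block₆ block₇ : Graph
block₄ = fromEdges block₄-edges
block₅ = fromEdges block₅-edges
block₆ = fromEdges block₆-edges
block₇ = fromEdges block₇-edges

blockGraph : ℕ → Graph
blockGraph 4 = block₄
blockGraph 5 = block₅
blockGraph 6 = block₆
blockGraph 7 = block₇
blockGraph (suc (suc (suc (suc n@(suc (suc (suc (suc _)))))))) = block₄ ⊕⟨ 4 ⟩ blockGraph n
blockGraph _ = fromEdges []

blockGraph-ind : (P : ℕ → Graph → Set) → P 4 block₄ → P 5 block₅ → P 6 block₆ → P 7 block₇ →
  (∀ {n G} → P n G → P (4 + n) (block₄ ⊕⟨ 4 ⟩ G)) → ∀ {n} → 4 ≤ n → P n (blockGraph n)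
blockGraph-ind P p₄ p₅ p₆ p₇ step {1} (s≤s ())
blockGraph-ind P p₄ p₅ p₆ p₇ step {2} (s≤s (s≤s ()))
blockGraph-ind P p₄ p₅ p₆ p₇ step {3} (s≤s (s≤s (s≤s ())))
blockGraph-ind P p₄ p₅ p₆ p₇ step {4} _ = p₄
blockGraph-ind P p₄ p₅ p₆ p₇ step {5} _ = p₅
blockGraph-ind P p₄ p₅ p₆ p₇ step {6} _ = p₆
blockGraph-ind P p₄ p₅ p₆ p₇ step {7} _ = p₇
blockGraph-ind P p₄ p₅ p₆ p₇ step {suc (suc (suc (suc n@(suc (suc (suc (suc _)))))))} _ =
  step (blockGraph-ind P p₄ p₅ p₆ p₇ step {n} (s≤s (s≤s (s≤s (s≤s z≤n)))))

blockGraph-symmetric : ∀ {n} → 4 ≤ n → Symmetric (blockGraph n)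
blockGraph-symmetric = blockGraph-ind (λ _ → Symmetric)
  (fromEdges-symmetric block₄-edges) (fromEdges-symmetric block₅-edges)
  (fromEdges-symmetric block₆-edges) (fromEdges-symmetric block₇-edges)
  (λ {_} {G} → ⊕-symmetric {block₄} {G} {4} (fromEdges-symmetric block₄-edges))

blockGraph-minDegree : ∀ {n} → 4 ≤ n → MinDegree n (blockGraph n) 2
blockGraph-minDegree = blockGraph-ind (λ n G → MinDegree n G 2)
  (checked 4 block₄) (checked 5 block₅) (checked 6 block₆) (checked 7 block₇)
  (λ {n} {G} → minDegree-⊕ {block₄} {G} {4} {n} (checked 4 block₄))
  where
  checked : ∀ n G {_ : True (minDegree? n G 2)} → MinDegree n G 2
  checked n G {ok} = toWitness ok

blockGraph-separating : ∀ {n} → 4 ≤ n → Separating n (blockGraph n)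
blockGraph-separating = blockGraph-ind Separating
  (checked 4 block₄) (checked 5 block₅) (checked 6 block₆) (checked 7 block₇)
  (λ {n} {G} → separating-⊕ {block₄} {G} {4} {n} (checked 4 block₄))
  where
  checked : ∀ n G {_ : True (separating? n G)} → Separating n G
  checked n G {ok} = toWitness ok

volume-blockGraph : ∀ {n} → 4 ≤ n → volume n (blockGraph n) ≤ 2 * n + 1 + n / 4
volume-blockGraph = blockGraph-ind (λ n G → volume n G ≤ 2 * n + 1 + n / 4)
  (n≤1+n 9) ≤-refl ≤-refl ≤-refl (λ {n} {G} → step {n} {G})
  where
  step : ∀ {n G} → volume n G ≤ 2 * n + 1 + n / 4 →
         volume (4 + n) (block₄ ⊕⟨ 4 ⟩ G) ≤ 2 * (4 + n) + 1 + (4 + n) / 4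
  step {n} {G} bound = begin
    volume (4 + n) (block₄ ⊕⟨ 4 ⟩ G) ≡⟨ volume-⊕ {block₄} {G} {4} {n} ⟩
    9 + volume n G                   ≤⟨ +-monoʳ-≤ 9 bound ⟩
    9 + (2 * n + 1 + n / 4)         ≡⟨ regroup n (n / 4) ⟩
    2 * (4 + n) + 1 + (1 + n / 4)   ≡⟨ cong (2 * (4 + n) + 1 +_) (sym (m/n≡1+[m∸n]/n (m≤m+n 4 n))) ⟩
    2 * (4 + n) + 1 + (4 + n) / 4   ∎
    where
    open ≤-Reasoning
    regroup : ∀ n q → 9 + (2 * n + 1 + q) ≡ 2 * (4 + n) + 1 + (1 + q)
    regroup = solve-∀

wdim₄-bound : ∀ {n} → 4 ≤ n → WdimLe n 4 (2 * n + 1 + n / 4)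
wdim₄-bound {n} 4≤n =
  edgeSet n (blockGraph n) ,
  edgeSet-isWeakResolving (≤-trans (n≤1+n 3) 4≤n)
    (blockGraph-symmetric 4≤n) (blockGraph-minDegree 4≤n) (blockGraph-separating 4≤n) ,
  ≤-trans (≤-reflexive (length-edgeSet {n} (blockGraph n))) (volume-blockGraph 4≤n)

mainTheorem5 : ∀ (n : ℕ) → 9 ≤ n → WdimLe n 4 (2 * n + 1 + n / 4)
mainTheorem5 n 9≤n = wdim₄-bound (≤-trans (m≤m+n 4 5) 9≤n)
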